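{- Let $N$ be a homogeneous network with asymmetric inputs and $\tilde{N}$ its fundamental network with set of cells $\tilde{C}$. (a) The following are equivalent: (i) $\tilde{N}$ is strongly connected; (ii) $\tilde{C}$ is a group; (iii) the representative functions $\sigma_1,\dots,\sigma_k$ of $N$ are bijections. (b) If $N$ is connected and $\tilde{N}$ is strongly connected, then $N$ is strongly connected.
   Context: A homogeneous network with asymmetric inputs has a finite cell set $C$, one cell type, $k$ edge types, each cell receiving exactly one edge of each type; it is represented by $\sigma_1,\dots,\sigma_k:C\to C$ (type-$i$ edge into $c$ comes from $\sigma_i(c)$). The fundamental network $\tilde{N}$ has as cells the semigroup $\tilde{C}$ of maps $C\to C$ generated under composition by $Id_C,\sigma_1,\dots,\sigma_k$, represented by $\tilde{\sigma}_i(\gamma)=\sigma_i\circ\gamma$. A network is connected if any two cells are joined by an undirected path (sequence of cells consecutive ones joined by an edge in either direction), and strongly connected if for any two cells there are directed paths from each to the other. "$\tilde{C}$ is a group" means it is a group under composition (with identity $Id_C$). -}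

module Defs where

open import Data.Nat using (ℕ)
open import Data.Fin using (Fin)
open import Data.List using (List; []; _∷_)
open import Data.Product using (Σ; _×_)
open import Function using (_∘_; id)
open import Function.Definitions using (Bijective)
open import Relation.Binary.PropositionalEquality using (_≡_; _≗_)

-- A homogeneous network with asymmetric inputs on the cell set C = Fin n
-- with k edge types, given by its representative functions
-- σ i : C → C  (the type-i edge into c comes from σ i c).
Network : ℕ → ℕ → Set
Network n k = Fin k → Fin n → Fin n

module _ {n k : ℕ} (σ : Network n k) where

  word : List (Fin k) → Fin n → Fin n
  word []      = id
  word (i ∷ w) = σ i ∘ word w

  -- γ is a cell of the fundamental network: an element of the semigroup
  -- generated by Id_C, σ_1, ..., σ_k under composition
  -- (maps compared pointwise).
  InC̃ : (Fin n → Fin n) → Set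
  InC̃ γ = Σ (List (Fin k)) λ w → word w ≗ γ

  data Path : Fin n → Fin n → Set where
    here : ∀ {a} → Path a a
    step : ∀ {a c} (i : Fin k) → Path a (σ i c) → Path a c

  data UPath : Fin n → Fin n → Set where
    here : ∀ {a} → UPath a a
    fwd  : ∀ {a c} (i : Fin k) → UPath a (σ i c) → UPath a c
    bwd  : ∀ {a c} (i : Fin k) → UPath a c → UPath a (σ i c)

  Connected : Set
  Connected = ∀ a b → UPath a b

  StronglyConnected : Set
  StronglyConnected = ∀ a b → Path a b

  -- Directed paths in the fundamental network Ñ: the type-i edge into γ
  -- comes from σ̃_i(γ) = σ i ∘ γ.  Cells are maps, equal when pointwise equal.
  data FPath : (Fin n → Fin n) → (Fin n → Fin n) → Set where
    here : ∀ {γ δ} → γ ≗ δ → FPath γ δ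
    step : ∀ {γ δ} (i : Fin k) → FPath γ (σ i ∘ δ) → FPath γ δ

  FundStronglyConnected : Set
  FundStronglyConnected = ∀ γ δ → InC̃ γ → InC̃ δ → FPath γ δ

  C̃IsGroup : Set
  C̃IsGroup = ∀ γ → InC̃ γ →
    Σ (Fin n → Fin n) λ δ → InC̃ δ × ((δ ∘ γ) ≗ id) × ((γ ∘ δ) ≗ id)

  AllBijections : Set
  AllBijections = ∀ i → Bijective _≡_ _≡_ (σ i)

-- A directed path in Ñ from γ to δ is a word w with γ = w ∘ δ, so strong
-- connectivity of Ñ says exactly that every γ ∈ C̃ has a left inverse in C̃;
-- in a monoid in which every element has a left inverse these are two-sided,
-- which gives (i) ⇔ (ii), and (ii) ⇒ (iii) is immediate.  Conversely, if every
-- σᵢ is a bijection then every γ ∈ C̃ is a permutation of the n cells; each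
-- orbit of γ has length at most n, hence dividing n!, so γ^(n!) = Id and
-- γ^(n!-1) ∈ C̃ is the inverse of γ.  For (b), the inverse of σᵢ in C̃ is a
-- word, i.e. a directed path reversing every edge of N, so undirected paths
-- can be replaced by directed ones.
module Submission where

open import Defs
open import Data.Nat using (ℕ; zero; suc; _+_; _*_; _≤_; pred; _!)
open import Data.Nat.Properties
  using (n<1+n; +-suc; +-comm; m≤n+m; ≤-trans; m≤n⇒∃[o]m+o≡n; suc-pred; _!≢0)
open import Data.Nat.Divisibility using (divides; ∣-trans; m∣m*n; m≤n⇒m!∣n!)
open import Data.Nat.GeneralisedArithmetic using (fold; fold-+)
open import Data.Fin using (Fin; toℕ)
open import Data.Fin.Properties using (pigeonhole; toℕ≤pred[n])
open import Data.List using (List; []; _∷_; _++_)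
open import Data.Product using (Σ; _×_; _,_; proj₁)
open import Function using (_∘_; id)
open import Function.Bundles using (_⇔_; mk⇔)
open import Function.Definitions using (Injective)
open import Function.Consequences.Propositional
  using (inverseᵇ⇒bijective; strictlyInverseˡ⇒inverseˡ; strictlyInverseʳ⇒inverseʳ)
open import Relation.Binary.PropositionalEquality

module _ {n : ℕ} (g : Fin n → Fin n) (g-injective : Injective _≡_ _≡_ g) where

  fold-injective : ∀ m {x y} → fold x g m ≡ fold y g m → x ≡ y
  fold-injective zero    eq = eq
  fold-injective (suc m) eq = fold-injective m (g-injective eq)

  orbit-period : ∀ c → Σ ℕ λ d → suc d ≤ n × fold c g (suc d) ≡ c
  orbit-period c with pigeonhole (n<1+n n) (λ a → fold c g (toℕ a))
  ... | i , j , i<j , gⁱc≡gʲc with m≤n⇒∃[o]m+o≡n i<j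
  ... | d , i+1+d≡j = d , period≤n , fold-injective (toℕ i) gⁱ⁺ᵈ⁺¹c≡gⁱc
    where
      j≡i+[1+d] : toℕ j ≡ toℕ i + suc d
      j≡i+[1+d] = trans (sym i+1+d≡j) (sym (+-suc (toℕ i) d))

      period≤n : suc d ≤ n
      period≤n = ≤-trans (subst (suc d ≤_) (sym j≡i+[1+d]) (m≤n+m (suc d) (toℕ i)))
                         (toℕ≤pred[n] j)

      gⁱ⁺ᵈ⁺¹c≡gⁱc : fold (fold c g (suc d)) g (toℕ i) ≡ fold c g (toℕ i)
      gⁱ⁺ᵈ⁺¹c≡gⁱc = begin
        fold (fold c g (suc d)) g (toℕ i) ≡⟨ fold-+ c g (toℕ i) ⟨
        fold c g (toℕ i + suc d)          ≡⟨ cong (fold c g) j≡i+[1+d] ⟨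
        fold c g (toℕ j)                  ≡⟨ gⁱc≡gʲc ⟨
        fold c g (toℕ i)                  ∎
        where open ≡-Reasoning

  fold-period-multiple : ∀ {c} d → fold c g d ≡ c → ∀ q → fold c g (q * d) ≡ c
  fold-period-multiple d gᵈc≡c zero = refl
  fold-period-multiple {c} d gᵈc≡c (suc q) = begin
    fold c g (d + q * d)          ≡⟨ fold-+ c g d ⟩
    fold (fold c g (q * d)) g d   ≡⟨ cong (λ x → fold x g d) (fold-period-multiple d gᵈc≡c q) ⟩
    fold c g d                    ≡⟨ gᵈc≡c ⟩
    c                             ∎
    where open ≡-Reasoning

  fold-n! : ∀ c → fold c g (n !) ≡ c
  fold-n! c with orbit-period c
  ... | d , 1+d≤n , gᵈ⁺¹c≡c with ∣-trans (m∣m*n (d !)) (m≤n⇒m!∣n! 1+d≤n)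
  ... | divides q n!≡q*[1+d] =
    trans (cong (fold c g) n!≡q*[1+d]) (fold-period-multiple (suc d) gᵈ⁺¹c≡c q)

  fold-pred-n!-inverseˡ : ∀ x → fold (g x) g (pred (n !)) ≡ x
  fold-pred-n!-inverseˡ x = begin
    fold (g x) g (pred (n !))   ≡⟨ fold-+ x g (pred (n !)) ⟨
    fold x g (pred (n !) + 1)   ≡⟨ cong (fold x g) (+-comm (pred (n !)) 1) ⟩
    fold x g (suc (pred (n !))) ≡⟨ cong (fold x g) (suc-pred (n !) {{n !≢0}}) ⟩
    fold x g (n !)              ≡⟨ fold-n! x ⟩
    x                           ∎
    where open ≡-Reasoning

module _ {n k : ℕ} (σ : Network n k) where

  word-++ : ∀ u v x → word σ (u ++ v) x ≡ word σ u (word σ v x)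
  word-++ []      v x = refl
  word-++ (i ∷ u) v x = cong (σ i) (word-++ u v x)

  InC̃-id : InC̃ σ id
  InC̃-id = [] , λ _ → refl

  InC̃-σ : ∀ i → InC̃ σ (σ i)
  InC̃-σ i = i ∷ [] , λ _ → refl

  InC̃-word : ∀ w → InC̃ σ (word σ w)
  InC̃-word w = w , λ _ → refl

  InC̃-∘ : ∀ {γ δ} → InC̃ σ γ → InC̃ σ δ → InC̃ σ (γ ∘ δ)
  InC̃-∘ {γ} {δ} (u , u≗γ) (v , v≗δ) =
    u ++ v , λ x → trans (word-++ u v x) (trans (u≗γ (word σ v x)) (cong γ (v≗δ x)))

  InC̃-fold : ∀ {γ} → InC̃ σ γ → ∀ m → InC̃ σ (λ x → fold x γ m)
  InC̃-fold γ∈C̃ zero    = InC̃-id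
  InC̃-fold γ∈C̃ (suc m) = InC̃-∘ γ∈C̃ (InC̃-fold γ∈C̃ m)

  HasLeftInverse : (Fin n → Fin n) → Set
  HasLeftInverse γ = Σ (Fin n → Fin n) λ δ → InC̃ σ δ × (δ ∘ γ) ≗ id

  leftInverses⇒C̃IsGroup : (∀ γ → InC̃ σ γ → HasLeftInverse γ) → C̃IsGroup σ
  leftInverses⇒C̃IsGroup inv γ γ∈C̃ with inv γ γ∈C̃
  ... | δ , δ∈C̃ , δγ≗id with inv δ δ∈C̃
  ... | ε , _ , εδ≗id = δ , δ∈C̃ , δγ≗id , γδ≗id
    where
      γ≗ε : γ ≗ ε
      γ≗ε x = trans (sym (εδ≗id (γ x))) (cong ε (δγ≗id x))

      γδ≗id : (γ ∘ δ) ≗ id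
      γδ≗id x = trans (γ≗ε (δ x)) (εδ≗id x)

  FPath-word : ∀ {γ δ} w → FPath σ γ (word σ w ∘ δ) → FPath σ γ δ
  FPath-word []      p = p
  FPath-word (i ∷ w) p = FPath-word w (step i p)

  word⇒FPath : ∀ {γ δ} w → γ ≗ word σ w ∘ δ → FPath σ γ δ
  word⇒FPath w γ≗wδ = FPath-word w (here γ≗wδ)

  FPath⇒word : ∀ {γ δ} → FPath σ γ δ → Σ (List (Fin k)) λ w → γ ≗ word σ w ∘ δ
  FPath⇒word (here γ≗δ) = [] , γ≗δ
  FPath⇒word {δ = δ} (step i p) with FPath⇒word p
  ... | w , γ≗wσδ = w ++ i ∷ [] , λ x → trans (γ≗wσδ x) (sym (word-++ w (i ∷ []) (δ x)))

  Path-word : ∀ {a c} w → Path σ a (word σ w c) → Path σ a c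
  Path-word []      p = p
  Path-word (i ∷ w) p = Path-word w (step i p)

  word⇒Path : ∀ {a c} w → a ≡ word σ w c → Path σ a c
  word⇒Path w refl = Path-word w here

  Path-trans : ∀ {a b c} → Path σ a b → Path σ b c → Path σ a c
  Path-trans p here       = p
  Path-trans p (step i q) = step i (Path-trans p q)

  FundStronglyConnected⇒C̃IsGroup : FundStronglyConnected σ → C̃IsGroup σ
  FundStronglyConnected⇒C̃IsGroup fsc = leftInverses⇒C̃IsGroup λ γ γ∈C̃ →
    let w , id≗wγ = FPath⇒word (fsc id γ InC̃-id γ∈C̃)
    in word σ w , InC̃-word w , λ x → sym (id≗wγ x)

  C̃IsGroup⇒FundStronglyConnected : C̃IsGroup σ → FundStronglyConnected σ
  C̃IsGroup⇒FundStronglyConnected grp γ δ γ∈C̃ δ∈C̃ with grp δ δ∈C̃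
  ... | δ⁻¹ , δ⁻¹∈C̃ , δ⁻¹δ≗id , _ with InC̃-∘ γ∈C̃ δ⁻¹∈C̃
  ... | w , w≗γδ⁻¹ =
    word⇒FPath w λ x → trans (cong γ (sym (δ⁻¹δ≗id x))) (sym (w≗γδ⁻¹ (δ x)))

  C̃IsGroup⇒AllBijections : C̃IsGroup σ → AllBijections σ
  C̃IsGroup⇒AllBijections grp i with grp (σ i) (InC̃-σ i)
  ... | δ , _ , δσ≗id , σδ≗id = inverseᵇ⇒bijective
    (strictlyInverseˡ⇒inverseˡ (σ i) σδ≗id , strictlyInverseʳ⇒inverseʳ (σ i) δσ≗id)

  InC̃-injective : AllBijections σ → ∀ {γ} → InC̃ σ γ → Injective _≡_ _≡_ γ
  InC̃-injective bij (w , w≗γ) γx≡γy =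
    word-injective w (trans (w≗γ _) (trans γx≡γy (sym (w≗γ _))))
    where
      word-injective : ∀ w → Injective _≡_ _≡_ (word σ w)
      word-injective []      eq = eq
      word-injective (i ∷ w) eq = word-injective w (proj₁ (bij i) eq)

  AllBijections⇒C̃IsGroup : AllBijections σ → C̃IsGroup σ
  AllBijections⇒C̃IsGroup bij = leftInverses⇒C̃IsGroup λ γ γ∈C̃ →
    (λ x → fold x γ (pred (n !))) , InC̃-fold γ∈C̃ (pred (n !)) ,
    fold-pred-n!-inverseˡ γ (InC̃-injective bij γ∈C̃)

  C̃IsGroup⇒reverseEdge : C̃IsGroup σ → ∀ i c → Path σ c (σ i c)
  C̃IsGroup⇒reverseEdge grp i c with grp (σ i) (InC̃-σ i)
  ... | δ , (w , w≗δ) , δσ≗id , _ = word⇒Path w (sym (trans (w≗δ (σ i c)) (δσ≗id c)))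

  reverseEdges⇒Connected⇒StronglyConnected :
    (∀ i c → Path σ c (σ i c)) → Connected σ → StronglyConnected σ
  reverseEdges⇒Connected⇒StronglyConnected rev conn a b = directed (conn a b)
    where
      directed : ∀ {a c} → UPath σ a c → Path σ a c
      directed here      = here
      directed (fwd i p) = step i (directed p)
      directed (bwd i p) = Path-trans (directed p) (rev i _)

mainTheorem15 : (n k : ℕ) (σ : Network n k) →
    ((FundStronglyConnected σ ⇔ C̃IsGroup σ) × (C̃IsGroup σ ⇔ AllBijections σ))
    × (Connected σ → FundStronglyConnected σ → StronglyConnected σ)
mainTheorem15 n k σ =
  ( mk⇔ (FundStronglyConnected⇒C̃IsGroup σ) (C̃IsGroup⇒FundStronglyConnected σ)
  , mk⇔ (C̃IsGroup⇒AllBijections σ) (AllBijections⇒C̃IsGroup σ) )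
  , λ conn fsc → reverseEdges⇒Connected⇒StronglyConnected σ
      (C̃IsGroup⇒reverseEdge σ (FundStronglyConnected⇒C̃IsGroup σ fsc)) conn
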